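{- Let $n\ge1$ and let $M$ be a multiset of size $n$ with elements in $\mathbb{Z}_n$ whose sum is congruent to $\binom n2$ modulo $n$. Then there exist a score sequence $s=(s_0,\dots,s_{n-1})$ of length $n$ and an integer $j\in\{0,\dots,n-1\}$ such that the multiset $\{s_0+j,s_1+j,\dots,s_{n-1}+j\}$, with elements taken in $\mathbb{Z}_n$, equals $M$.
   Context: A score sequence is the nondecreasing sequence of out-degrees of the vertices of a tournament; equivalently (Landau), integers $(s_0,\dots,s_{n-1})$ with $0\le s_0\le\cdots\le s_{n-1}\le n-1$, $s_0+\dots+s_{k-1}\ge\binom{k}{2}$ for $1\le k<n$, and $s_0+\dots+s_{n-1}=\binom n2$. -}

module Defs where

open import Data.Nat using (ℕ; zero; suc; _+_; _≤_; _<_; _∸_; NonZero)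
open import Data.Nat.Combinatorics using (_C_)
open import Data.Fin using (Fin; toℕ)
open import Data.Vec using (Vec; lookup; take; toList)
open import Data.List using (List; take)
open import Data.Nat.ListAction using (sum)
open import Relation.Binary.PropositionalEquality using (_≡_)

prefixSum : {n : ℕ} → Vec ℕ n → ℕ → ℕ
prefixSum s k = sum (Data.List.take k (toList s))

-- Score sequence of length n, via Landau's characterization as in the paper:
-- 0 ≤ s_0 ≤ ... ≤ s_{n-1} ≤ n-1, prefix sums of length k (1 ≤ k < n) are
-- at least C(k,2), and the total sum is C(n,2).
record IsScoreSequence (n : ℕ) (s : Vec ℕ n) : Set where
  field
    nondecreasing : ∀ (i j : Fin n) → toℕ i ≤ toℕ j → lookup s i ≤ lookup s j
    bounded       : ∀ (i : Fin n) → lookup s i ≤ n ∸ 1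
    landau        : ∀ (k : ℕ) → 1 ≤ k → k < n → k C 2 ≤ prefixSum s k
    total         : prefixSum s n ≡ n C 2

-- Sort M as a₀ ≤ ⋯ ≤ a_{n-1} and unroll it to a₀, …, a_{n-1}, a₀ + n, …, a_{n-1} + n.
-- The gaps dᵢ = aᵢ + n − i are n-periodic, and the congruence on ΣM says exactly that
-- their sum over a period is n·μ for some μ. By the cycle lemma some rotation p of the
-- gaps has every partial sum over K terms at least K·μ; then sₖ = a_{p+k} + n − p − μ
-- is nondecreasing, bounded by n − 1 and satisfies Landau's inequalities, and adding
-- j = p + μ to it gives back the a_{p+k} modulo n, a rotation of M.
module Submission where

open import Defs
open import Data.Fin using (Fin; toℕ)
open import Data.Fin.Properties using (toℕ<n; fromℕ<-cong; fromℕ<-toℕ; toℕ-fromℕ<)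
open import Data.List as List using (List; []; _∷_; _++_; applyUpTo; upTo; take; length)
open import Data.List.Extrema.Nat using (argmin; argmin-all; f[argmin]≤f[xs])
open import Data.List.Membership.Propositional.Properties using (∈-upTo⁺)
open import Data.List.Properties using (map-applyUpTo)
open import Data.List.Relation.Binary.Permutation.Propositional using (_↭_; ↭-reflexive; ↭-sym; ↭-trans; module PermutationReasoning)
open import Data.List.Relation.Binary.Permutation.Propositional.Properties using (++-comm; ↭-length; All-resp-↭; map⁺)
open import Data.List.Relation.Unary.All as All using (All; []; _∷_)
open import Data.List.Relation.Unary.All.Properties using (all-upTo; applyUpTo⁻)
open import Data.List.Relation.Unary.Linked using (Linked; [-]; _∷_)
open import Data.Nat using (ℕ; zero; suc; _+_; _*_; _∸_; _≤_; _<_; z≤n; s≤s; s≤s⁻¹; z<s; s<s; NonZero; _<?_; _≤?_; >-nonZero⁻¹)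
open import Data.Nat.Combinatorics using (_C_; nC1≡n; nCk+nC[k+1]≡[n+1]C[k+1])
open import Data.Nat.DivMod using (_mod_; _%_; _/_; m≡m%n+[m/n]*n; m<n⇒m%n≡m; %-distribˡ-+; m%n%n≡m%n; [m+n]%n≡m%n)
open import Data.Nat.Divisibility using (_∣_; divides; quotient; ∣m+n∣m⇒∣n; n∣m*n; m∣n⇒n≡m*quotient)
open import Data.Nat.ListAction using (sum)
open import Data.Nat.ListAction.Properties using (sum-++; sum-↭)
open import Data.Nat.Properties
open import Data.List.Sort ≤-decTotalOrder using (sort; sort-↭; sort-↗)
open import Algebra.Properties.CommutativeSemigroup +-commutativeSemigroup using (interchange)
open import Data.Nat.Tactic.RingSolver using (solve-∀)
open import Data.Product using (Σ; ∃-syntax; _×_; _,_)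
open import Data.Sum using (inj₁; inj₂)
open import Data.Vec using (Vec; []; _∷_; toList; map; tabulate; lookup)
open import Data.Vec.Properties using (toList-map; lookup∘tabulate; length-toList)
open import Function using (_∘_; case_of_)
open import Relation.Binary.PropositionalEquality
open import Relation.Nullary using (yes; no)
open import Relation.Nullary.Negation using (contradiction)

∑< : ℕ → (ℕ → ℕ) → ℕ
∑< n f = sum (applyUpTo f n)

applyUpTo-cong : ∀ {A : Set} {f g : ℕ → A} n → (∀ {k} → k < n → f k ≡ g k) →
                 applyUpTo f n ≡ applyUpTo g n
applyUpTo-cong zero    f≗g = refl
applyUpTo-cong (suc n) f≗g = cong₂ _∷_ (f≗g z<s) (applyUpTo-cong n (f≗g ∘ s<s))

applyUpTo-++ : ∀ {A : Set} (f : ℕ → A) m n →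
               applyUpTo f (m + n) ≡ applyUpTo f m ++ applyUpTo (λ k → f (m + k)) n
applyUpTo-++ f zero    n = refl
applyUpTo-++ f (suc m) n = cong (f 0 ∷_) (applyUpTo-++ (f ∘ suc) m n)

take-applyUpTo : ∀ {A : Set} (f : ℕ → A) {m n} → m ≤ n → take m (applyUpTo f n) ≡ applyUpTo f m
take-applyUpTo f z≤n       = refl
take-applyUpTo f (s≤s m≤n) = cong (f 0 ∷_) (take-applyUpTo (f ∘ suc) m≤n)

applyUpTo-rotate : ∀ {A : Set} (g : ℕ → A) {n p} → p ≤ n →
                   (∀ {k} → k < n → g (n + k) ≡ g k) →
                   applyUpTo (λ k → g (p + k)) n ↭ applyUpTo g n
applyUpTo-rotate g {n} {p} p≤n periodic = begin
  applyUpTo (λ k → g (p + k)) n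
    ≡⟨ cong (applyUpTo _) (m∸n+n≡m p≤n) ⟨
  applyUpTo (λ k → g (p + k)) (d + p)
    ≡⟨ applyUpTo-++ _ d p ⟩
  applyUpTo (λ k → g (p + k)) d ++ applyUpTo (λ k → g (p + (d + k))) p
    ≡⟨ cong (applyUpTo (λ k → g (p + k)) d ++_) (applyUpTo-cong p wrap) ⟩
  applyUpTo (λ k → g (p + k)) d ++ applyUpTo g p
    ↭⟨ ++-comm _ (applyUpTo g p) ⟩
  applyUpTo g p ++ applyUpTo (λ k → g (p + k)) d
    ≡⟨ applyUpTo-++ g p d ⟨
  applyUpTo g (p + d)
    ≡⟨ cong (applyUpTo g) (m+[n∸m]≡n p≤n) ⟩
  applyUpTo g n ∎
  where
  open PermutationReasoning
  d : ℕ
  d = n ∸ p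
  wrap : ∀ {k} → k < p → g (p + (d + k)) ≡ g k
  wrap {k} k<p = trans (cong g (trans (sym (+-assoc p d k)) (cong (_+ k) (m+[n∸m]≡n p≤n))))
                       (periodic (<-≤-trans k<p p≤n))

∑<-cong : ∀ {f g} n → (∀ {k} → k < n → f k ≡ g k) → ∑< n f ≡ ∑< n g
∑<-cong n f≗g = cong sum (applyUpTo-cong n f≗g)

∑<-split : ∀ f m n → ∑< (m + n) f ≡ ∑< m f + ∑< n (λ k → f (m + k))
∑<-split f m n = trans (cong sum (applyUpTo-++ f m n)) (sum-++ (applyUpTo f m) _)

∑<-suc : ∀ f n → ∑< (suc n) f ≡ ∑< n f + f n
∑<-suc f zero    = +-identityʳ (f 0)
∑<-suc f (suc n) = trans (cong (f 0 +_) (∑<-suc (f ∘ suc) n)) (sym (+-assoc (f 0) _ _))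

∑<-distrib-+ : ∀ f g n → ∑< n (λ k → f k + g k) ≡ ∑< n f + ∑< n g
∑<-distrib-+ f g zero    = refl
∑<-distrib-+ f g (suc n) = trans (cong (f 0 + g 0 +_) (∑<-distrib-+ (f ∘ suc) (g ∘ suc) n))
                                 (interchange (f 0) (g 0) _ _)

∑<-const : ∀ c n → ∑< n (λ _ → c) ≡ n * c
∑<-const c zero    = refl
∑<-const c (suc n) = cong (c +_) (∑<-const c n)

∑<-id : ∀ n → ∑< n (λ k → k) ≡ n C 2
∑<-id zero    = refl
∑<-id (suc n) = begin
  ∑< (suc n) (λ k → k) ≡⟨ ∑<-suc (λ k → k) n ⟩
  ∑< n (λ k → k) + n   ≡⟨ cong₂ _+_ (∑<-id n) (sym (nC1≡n n)) ⟩
  n C 2 + n C 1        ≡⟨ +-comm (n C 2) (n C 1) ⟩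
  n C 1 + n C 2        ≡⟨ nCk+nC[k+1]≡[n+1]C[k+1] n 1 ⟩
  suc n C 2            ∎
  where open ≡-Reasoning

∣-by-congruence : ∀ n .{{_ : NonZero n}} {x c s} k → s % n ≡ c % n → x + c ≡ s + k * n → n ∣ x
∣-by-congruence n {x} {c} {s} k s≡c x+c≡ =
  ∣m+n∣m⇒∣n (divides (s / n + k) (+-cancelˡ-≡ (c % n) _ _ shifted)) (n∣m*n (c / n))
  where
  open ≡-Reasoning
  regroup : ∀ a b c d → a + b * d + c * d ≡ a + (b + c) * d
  regroup = solve-∀
  shifted : c % n + (c / n * n + x) ≡ c % n + (s / n + k) * n
  shifted = begin
    c % n + (c / n * n + x)   ≡⟨ +-assoc (c % n) _ x ⟨
    c % n + c / n * n + x     ≡⟨ cong (_+ x) (m≡m%n+[m/n]*n c n) ⟨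
    c + x                     ≡⟨ +-comm c x ⟩
    x + c                     ≡⟨ x+c≡ ⟩
    s + k * n                 ≡⟨ cong (λ t → t + k * n) (m≡m%n+[m/n]*n s n) ⟩
    s % n + s / n * n + k * n ≡⟨ cong (λ t → t + s / n * n + k * n) s≡c ⟩
    c % n + s / n * n + k * n ≡⟨ regroup (c % n) (s / n) k n ⟩
    c % n + (s / n + k) * n   ∎

m∸n≡o+[m∸[n+o]] : ∀ {m n o} → n + o ≤ m → m ∸ n ≡ o + (m ∸ (n + o))
m∸n≡o+[m∸[n+o]] {m} {n} {o} n+o≤m = begin
  m ∸ n                       ≡⟨ cong (_∸ n) (m+[n∸m]≡n n+o≤m) ⟨
  n + o + (m ∸ (n + o)) ∸ n   ≡⟨ cong (_∸ n) (+-assoc n o _) ⟩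
  n + (o + (m ∸ (n + o))) ∸ n ≡⟨ m+n∸m≡n n _ ⟩
  o + (m ∸ (n + o))           ∎
  where open ≡-Reasoning

potential-increment : ∀ {a b N q K} μ → q + K ≤ N →
                      a + (N ∸ q) * μ ≤ b + (N ∸ (q + K)) * μ → a + K * μ ≤ b
potential-increment {a} {b} {N} {q} {K} μ q+K≤N Φq≤Φq+K = +-cancelʳ-≤ (R * μ) _ _ (begin
  a + K * μ + R * μ   ≡⟨ +-assoc a _ _ ⟩
  a + (K * μ + R * μ) ≡⟨ cong (a +_) (*-distribʳ-+ μ K R) ⟨
  a + (K + R) * μ     ≡⟨ cong (λ t → a + t * μ) (m∸n≡o+[m∸[n+o]] {N} {q} {K} q+K≤N) ⟨
  a + (N ∸ q) * μ     ≤⟨ Φq≤Φq+K ⟩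
  b + R * μ           ∎)
  where
  open ≤-Reasoning
  R : ℕ
  R = N ∸ (q + K)

cycle-lemma : ∀ {n} .{{_ : NonZero n}} (y : ℕ → ℕ) μ →
              (∀ {k} → k < n → y (n + k) ≡ y k) → ∑< n y ≡ n * μ →
              ∃[ p ] p < n × (∀ {K} → K ≤ n → K * μ ≤ ∑< K (λ k → y (p + k)))
cycle-lemma {n} y μ periodic ∑y≡nμ = p , p<n , climb
  where
  Y : ℕ → ℕ
  Y q = ∑< q y

  -- Y q − q μ, shifted by 2n μ to stay in ℕ on [0, 2n].
  Φ : ℕ → ℕ
  Φ q = Y q + (n + n ∸ q) * μ

  p : ℕ
  p = argmin Φ 0 (upTo n)

  p<n : p < n
  p<n = argmin-all Φ (>-nonZero⁻¹ n) (all-upTo n)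

  Y-periodic : ∀ {i} → i ≤ n → Y (n + i) ≡ n * μ + Y i
  Y-periodic {i} i≤n = trans (∑<-split y n i)
    (cong₂ _+_ ∑y≡nμ (∑<-cong i (λ k<i → periodic (<-≤-trans k<i i≤n))))

  Φ-periodic : ∀ {i} → i ≤ n → Φ (n + i) ≡ Φ i
  Φ-periodic {i} i≤n = begin
    Y (n + i) + (n + n ∸ (n + i)) * μ ≡⟨ cong₂ (λ a b → a + b * μ) (Y-periodic i≤n) ([m+n]∸[m+o]≡n∸o n n i) ⟩
    n * μ + Y i + (n ∸ i) * μ         ≡⟨ regroup n (Y i) (n ∸ i) μ ⟩
    Y i + (n + (n ∸ i)) * μ           ≡⟨ cong (λ t → Y i + t * μ) (+-∸-assoc n i≤n) ⟨
    Φ i                               ∎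
    where
    open ≡-Reasoning
    regroup : ∀ a b c d → a * d + b + c * d ≡ b + (a + c) * d
    regroup = solve-∀

  minimal-<n : ∀ {q} → q < n → Φ p ≤ Φ q
  minimal-<n q<n = All.lookup (f[argmin]≤f[xs] 0 (upTo n)) (∈-upTo⁺ q<n)

  minimal-≤n : ∀ {q} → q ≤ n → Φ p ≤ Φ q
  minimal-≤n q≤n with m≤n⇒m<n∨m≡n q≤n
  ... | inj₁ q<n  = minimal-<n q<n
  ... | inj₂ refl = ≤-trans (minimal-<n (>-nonZero⁻¹ n))
                            (≤-reflexive (trans (sym (Φ-periodic z≤n)) (cong Φ (+-identityʳ n))))

  -- The periodicity of Φ carries minimality from [0, n] over to [0, 2n].
  minimal-≤2n : ∀ {q} → q ≤ n + n → Φ p ≤ Φ q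
  minimal-≤2n {q} q≤2n with q ≤? n
  ... | yes q≤n = minimal-≤n q≤n
  ... | no  q≰n = subst (λ t → Φ p ≤ Φ t) (m+[n∸m]≡n n≤q)
                        (≤-trans (minimal-≤n i≤n) (≤-reflexive (sym (Φ-periodic i≤n))))
    where
    n≤q : n ≤ q
    n≤q = <⇒≤ (≰⇒> q≰n)
    i≤n : q ∸ n ≤ n
    i≤n = m≤n+o⇒m∸n≤o q n q≤2n

  climb : ∀ {K} → K ≤ n → K * μ ≤ ∑< K (λ k → y (p + k))
  climb {K} K≤n = +-cancelˡ-≤ (Y p) _ _ (subst (Y p + K * μ ≤_) (∑<-split y p K)
    (potential-increment {Y p} {Y (p + K)} {n + n} {p} {K} μ p+K≤2n (minimal-≤2n p+K≤2n)))
    where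
    p+K≤2n : p + K ≤ n + n
    p+K≤2n = +-mono-≤ (<⇒≤ p<n) K≤n

nth : List ℕ → ℕ → ℕ
nth []       _       = 0
nth (x ∷ xs) zero    = x
nth (x ∷ xs) (suc i) = nth xs i

applyUpTo-nth : ∀ xs → applyUpTo (nth xs) (length xs) ≡ xs
applyUpTo-nth []       = refl
applyUpTo-nth (x ∷ xs) = cong (x ∷_) (applyUpTo-nth xs)

nth-mono : ∀ {xs} → Linked _≤_ xs → ∀ {i j} → i ≤ j → j < length xs → nth xs i ≤ nth xs j
nth-mono [-]      {zero}  {zero}  _         _         = ≤-refl
nth-mono [-]      {_}     {suc j} _         (s<s ())
nth-mono (x≤y ∷ ↗) {zero}  {zero}  _         _         = ≤-refl
nth-mono (x≤y ∷ ↗) {zero}  {suc j} _         (s<s j<) = ≤-trans x≤y (nth-mono ↗ z≤n j<)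
nth-mono (x≤y ∷ ↗) {suc i} {suc j} (s≤s i≤j) (s<s j<) = nth-mono ↗ i≤j j<

nondecreasing-enumeration : ∀ {n} (xs : Vec ℕ n) → Σ (ℕ → ℕ) λ A →
  (∀ {i j} → i ≤ j → j < n → A i ≤ A j) × applyUpTo A n ↭ toList xs
nondecreasing-enumeration {n} xs = nth sorted , mono , enumerates
  where
  sorted : List ℕ
  sorted = sort (toList xs)
  length-sorted : length sorted ≡ n
  length-sorted = trans (↭-length (sort-↭ (toList xs))) (length-toList xs)
  mono : ∀ {i j} → i ≤ j → j < n → nth sorted i ≤ nth sorted j
  mono i≤j j<n = nth-mono (sort-↗ (toList xs)) i≤j (subst (_ <_) (sym length-sorted) j<n)
  enumerates : applyUpTo (nth sorted) n ↭ toList xs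
  enumerates = subst (_↭ toList xs)
    (trans (sym (applyUpTo-nth sorted)) (cong (applyUpTo (nth sorted)) length-sorted))
    (sort-↭ (toList xs))

toList-tabulate-toℕ : ∀ {n} (f : ℕ → ℕ) → toList (tabulate {n = n} (f ∘ toℕ)) ≡ applyUpTo f n
toList-tabulate-toℕ {zero}  f = refl
toList-tabulate-toℕ {suc n} f = cong (f 0 ∷_) (toList-tabulate-toℕ (f ∘ suc))

isScoreSequence-tabulate : ∀ {n} (f : ℕ → ℕ) →
  (∀ {i j} → i ≤ j → j < n → f i ≤ f j) → (∀ {i} → i < n → f i ≤ n ∸ 1) →
  (∀ {K} → K < n → K C 2 ≤ ∑< K f) → ∑< n f ≡ n C 2 →
  IsScoreSequence n (tabulate (f ∘ toℕ))
isScoreSequence-tabulate {n} f mono bounded landau total = record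
  { nondecreasing = λ i j i≤j → subst₂ _≤_ (sym (entry i)) (sym (entry j)) (mono i≤j (toℕ<n j))
  ; bounded       = λ i → subst (_≤ n ∸ 1) (sym (entry i)) (bounded (toℕ<n i))
  ; landau        = λ K _ K<n → subst (K C 2 ≤_) (sym (prefix (<⇒≤ K<n))) (landau K<n)
  ; total         = trans (prefix ≤-refl) total
  }
  where
  entry : ∀ i → lookup (tabulate (f ∘ toℕ)) i ≡ f (toℕ i)
  entry = lookup∘tabulate (f ∘ toℕ)
  prefix : ∀ {K} → K ≤ n → prefixSum (tabulate (f ∘ toℕ)) K ≡ ∑< K f
  prefix {K} K≤n = trans (cong (sum ∘ take K) (toList-tabulate-toℕ f)) (cong sum (take-applyUpTo f K≤n))

mod-cong : ∀ {n} .{{_ : NonZero n}} x y → x % n ≡ y % n → x mod n ≡ y mod n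
mod-cong _ _ x%n≡y%n = fromℕ<-cong _ _ x%n≡y%n _ _

mod-toℕ : ∀ {n} .{{_ : NonZero n}} (i : Fin n) → toℕ i mod n ≡ i
mod-toℕ i = trans (fromℕ<-cong _ _ (m<n⇒m%n≡m (toℕ<n i)) _ (toℕ<n i)) (fromℕ<-toℕ i _)

[m+n%o]%o≡[m+n]%o : ∀ a b n .{{_ : NonZero n}} → (a + b % n) % n ≡ (a + b) % n
[m+n%o]%o≡[m+n]%o a b n = begin
  (a + b % n) % n         ≡⟨ %-distribˡ-+ a (b % n) n ⟩
  (a % n + b % n % n) % n ≡⟨ cong (λ t → (a % n + t) % n) (m%n%n≡m%n b n) ⟩
  (a % n + b % n) % n     ≡⟨ %-distribˡ-+ a b n ⟨
  (a + b) % n             ∎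
  where open ≡-Reasoning

all-toℕ<n : ∀ {n k} (xs : Vec (Fin n) k) → All (_< n) (toList (map toℕ xs))
all-toℕ<n []       = []
all-toℕ<n (x ∷ xs) = toℕ<n x ∷ all-toℕ<n xs

map-mod-toℕ : ∀ {n k} .{{_ : NonZero n}} (xs : Vec (Fin n) k) →
                  List.map (_mod n) (toList (map toℕ xs)) ≡ toList xs
map-mod-toℕ []       = refl
map-mod-toℕ (x ∷ xs) = cong₂ _∷_ (mod-toℕ x) (map-mod-toℕ xs)

ShiftedScoreSequence : (n : ℕ) .{{_ : NonZero n}} → List (Fin n) → Set
ShiftedScoreSequence n xs = Σ (Vec ℕ n) λ s → Σ (Fin n) λ j →
  IsScoreSequence n s × toList (map (λ x → (x + toℕ j) mod n) s) ↭ xs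

ShiftedScoreSequence-resp-↭ : ∀ {n} .{{_ : NonZero n}} {xs ys} → xs ↭ ys →
                              ShiftedScoreSequence n xs → ShiftedScoreSequence n ys
ShiftedScoreSequence-resp-↭ xs↭ys (s , j , s-score , s↭xs) = s , j , s-score , ↭-trans s↭xs xs↭ys

module RotatedScores (m : ℕ) (A : ℕ → ℕ)
  (A-mono : ∀ {i j} → i ≤ j → j < suc m → A i ≤ A j)
  (A<n : ∀ {i} → i < suc m → A i < suc m)
  (∑A≡ : ∑< (suc m) A % suc m ≡ (suc m C 2) % suc m) where

  n : ℕ
  n = suc m

  unrolled : ℕ → ℕ
  unrolled i with i <? n
  ... | yes _ = A i
  ... | no  _ = A (i ∸ n) + n

  unrolled-< : ∀ {i} → i < n → unrolled i ≡ A i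
  unrolled-< {i} i<n with i <? n
  ... | yes _   = refl
  ... | no  i≮n = contradiction i<n i≮n

  unrolled-+ : ∀ k → unrolled (n + k) ≡ A k + n
  unrolled-+ k with n + k <? n
  ... | yes n+k<n = contradiction n+k<n (≤⇒≯ (m≤m+n n k))
  ... | no  _     = cong (λ i → A i + n) (m+n∸m≡n n k)

  unrolled-mono : ∀ {i j} → i ≤ j → j < n + n → unrolled i ≤ unrolled j
  unrolled-mono {i} {j} i≤j j<2n with i <? n | j <? n
  ... | yes i<n | yes j<n = A-mono i≤j j<n
  ... | yes i<n | no  _   = ≤-trans (<⇒≤ (A<n i<n)) (m≤n+m n _)
  ... | no  i≮n | yes j<n = contradiction (≤-<-trans i≤j j<n) i≮n
  ... | no  _   | no  _   = +-monoˡ-≤ n (A-mono (∸-monoˡ-≤ n i≤j) (m<n+o⇒m∸n<o j n j<2n))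

  index≤unrolled+n : ∀ {i} → i < n + n → i ≤ unrolled i + n
  index≤unrolled+n {i} i<2n with i <? n
  ... | yes i<n = ≤-trans (<⇒≤ i<n) (m≤n+m n _)
  ... | no  _   = ≤-trans (<⇒≤ i<2n) (+-monoˡ-≤ n (m≤n+m n _))

  gap : ℕ → ℕ
  gap i = unrolled i + n ∸ i

  gap+index : ∀ {i} → i < n + n → gap i + i ≡ unrolled i + n
  gap+index i<2n = m∸n+n≡m (index≤unrolled+n i<2n)

  gap+index-< : ∀ {k} → k < n → gap k + k ≡ A k + n
  gap+index-< k<n = trans (gap+index (<-≤-trans k<n (m≤m+n n n))) (cong (_+ n) (unrolled-< k<n))

  gap-periodic : ∀ {k} → k < n → gap (n + k) ≡ gap k
  gap-periodic {k} k<n = +-cancelʳ-≡ (n + k) _ _ (begin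
    gap (n + k) + (n + k) ≡⟨ gap+index (+-monoʳ-< n k<n) ⟩
    unrolled (n + k) + n  ≡⟨ cong (_+ n) (unrolled-+ k) ⟩
    A k + n + n           ≡⟨ cong (_+ n) (gap+index-< k<n) ⟨
    gap k + k + n         ≡⟨ +-assoc (gap k) k n ⟩
    gap k + (k + n)       ≡⟨ cong (gap k +_) (+-comm k n) ⟩
    gap k + (n + k)       ∎)
    where open ≡-Reasoning

  ∑gap : ∑< n gap + n C 2 ≡ ∑< n A + n * n
  ∑gap = begin
    ∑< n gap + n C 2                   ≡⟨ cong (∑< n gap +_) (∑<-id n) ⟨
    ∑< n gap + ∑< n (λ k → k)          ≡⟨ ∑<-distrib-+ gap (λ k → k) n ⟨
    ∑< n (λ k → gap k + k)             ≡⟨ ∑<-cong n gap+index-< ⟩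
    ∑< n (λ k → A k + n)               ≡⟨ ∑<-distrib-+ A (λ _ → n) n ⟩
    ∑< n A + ∑< n (λ _ → n)            ≡⟨ cong (∑< n A +_) (∑<-const n n) ⟩
    ∑< n A + n * n                     ∎
    where open ≡-Reasoning

  module Scores (μ : ℕ) (∑gap≡nμ : ∑< n gap ≡ n * μ) (p : ℕ) (p<n : p < n)
    (climb : ∀ {K} → K ≤ n → K * μ ≤ ∑< K (λ k → gap (p + k))) where

    μ≤gap-p : μ ≤ gap p
    μ≤gap-p = subst₂ _≤_ (*-identityˡ μ) (trans (+-identityʳ _) (cong gap (+-identityʳ p))) (climb (s≤s z≤n))

    p+k<2n : ∀ {k} → k < n → p + k < n + n
    p+k<2n = +-mono-< p<n

    p+μ≤unrolled : ∀ {k} → k < n → p + μ ≤ unrolled (p + k) + n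
    p+μ≤unrolled {k} k<n = begin
      p + μ                  ≤⟨ +-monoʳ-≤ p μ≤gap-p ⟩
      p + gap p              ≡⟨ +-comm p (gap p) ⟩
      gap p + p              ≡⟨ gap+index (<-≤-trans p<n (m≤m+n n n)) ⟩
      unrolled p + n         ≤⟨ +-monoˡ-≤ n (unrolled-mono (m≤m+n p k) (p+k<2n k<n)) ⟩
      unrolled (p + k) + n   ∎
      where open ≤-Reasoning

    score : ℕ → ℕ
    score k = unrolled (p + k) + n ∸ (p + μ)

    score+μ : ∀ {k} → k < n → score k + μ ≡ gap (p + k) + k
    score+μ {k} k<n = +-cancelʳ-≡ p _ _ (begin
      score k + μ + p           ≡⟨ +-assoc (score k) μ p ⟩
      score k + (μ + p)         ≡⟨ cong (score k +_) (+-comm μ p) ⟩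
      score k + (p + μ)         ≡⟨ m∸n+n≡m (p+μ≤unrolled k<n) ⟩
      unrolled (p + k) + n      ≡⟨ gap+index (p+k<2n k<n) ⟨
      gap (p + k) + (p + k)     ≡⟨ cong (gap (p + k) +_) (+-comm p k) ⟩
      gap (p + k) + (k + p)     ≡⟨ +-assoc (gap (p + k)) k p ⟨
      gap (p + k) + k + p       ∎)
      where open ≡-Reasoning

    ∑score : ∀ {K} → K ≤ n → ∑< K score + K * μ ≡ ∑< K (λ k → gap (p + k)) + K C 2
    ∑score {K} K≤n = begin
      ∑< K score + K * μ                              ≡⟨ cong (∑< K score +_) (∑<-const μ K) ⟨
      ∑< K score + ∑< K (λ _ → μ)                     ≡⟨ ∑<-distrib-+ score (λ _ → μ) K ⟨
      ∑< K (λ k → score k + μ)                        ≡⟨ ∑<-cong K (λ k<K → score+μ (<-≤-trans k<K K≤n)) ⟩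
      ∑< K (λ k → gap (p + k) + k)                    ≡⟨ ∑<-distrib-+ (λ k → gap (p + k)) (λ k → k) K ⟩
      ∑< K (λ k → gap (p + k)) + ∑< K (λ k → k)       ≡⟨ cong (∑< K (λ k → gap (p + k)) +_) (∑<-id K) ⟩
      ∑< K (λ k → gap (p + k)) + K C 2                ∎
      where open ≡-Reasoning

    ∑rotated-gap : ∑< n (λ k → gap (p + k)) ≡ n * μ
    ∑rotated-gap = trans (sum-↭ (applyUpTo-rotate gap (<⇒≤ p<n) gap-periodic)) ∑gap≡nμ

    score-landau : ∀ {K} → K ≤ n → K C 2 ≤ ∑< K score
    score-landau {K} K≤n = +-cancelʳ-≤ (K * μ) _ _ (begin
      K C 2 + K * μ                        ≡⟨ +-comm (K C 2) (K * μ) ⟩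
      K * μ + K C 2                        ≤⟨ +-monoˡ-≤ (K C 2) (climb K≤n) ⟩
      ∑< K (λ k → gap (p + k)) + K C 2     ≡⟨ ∑score K≤n ⟨
      ∑< K score + K * μ                   ∎)
      where open ≤-Reasoning

    score-total : ∑< n score ≡ n C 2
    score-total = +-cancelʳ-≡ (n * μ) (∑< n score) (n C 2)
      (trans (∑score ≤-refl) (trans (cong (_+ n C 2) ∑rotated-gap) (+-comm (n * μ) (n C 2))))

    score-mono : ∀ {i j} → i ≤ j → j < n → score i ≤ score j
    score-mono i≤j j<n = ∸-monoˡ-≤ (p + μ) (+-monoˡ-≤ n (unrolled-mono (+-monoʳ-≤ p i≤j) (p+k<2n j<n)))

    -- The first m rotated gaps already sum to at least m μ, leaving at most μ for the last.
    last-gap≤μ : gap (p + m) ≤ μ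
    last-gap≤μ = +-cancelˡ-≤ (∑< m (λ k → gap (p + k))) _ _ (begin
      ∑< m (λ k → gap (p + k)) + gap (p + m) ≡⟨ ∑<-suc (λ k → gap (p + k)) m ⟨
      ∑< n (λ k → gap (p + k))               ≡⟨ ∑rotated-gap ⟩
      n * μ                                  ≡⟨ +-comm μ (m * μ) ⟩
      m * μ + μ                              ≤⟨ +-monoˡ-≤ μ (climb (n≤1+n m)) ⟩
      ∑< m (λ k → gap (p + k)) + μ           ∎)
      where open ≤-Reasoning

    score-bounded : ∀ {k} → k < n → score k ≤ m
    score-bounded k<n = ≤-trans (score-mono (s≤s⁻¹ k<n) ≤-refl) (+-cancelʳ-≤ μ (score m) m (begin
      score m + μ        ≡⟨ score+μ ≤-refl ⟩
      gap (p + m) + m    ≤⟨ +-monoˡ-≤ m last-gap≤μ ⟩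
      μ + m              ≡⟨ +-comm μ m ⟩
      m + μ              ∎))
      where open ≤-Reasoning

    shift : Fin n
    shift = (p + μ) mod n

    residue : ℕ → Fin n
    residue i = unrolled i mod n

    residue-periodic : ∀ {k} → k < n → residue (n + k) ≡ residue k
    residue-periodic {k} k<n = mod-cong (unrolled (n + k)) (unrolled k) (begin
      unrolled (n + k) % n ≡⟨ cong (_% n) (unrolled-+ k) ⟩
      (A k + n) % n        ≡⟨ [m+n]%n≡m%n (A k) n ⟩
      A k % n              ≡⟨ cong (_% n) (unrolled-< k<n) ⟨
      unrolled k % n       ∎)
      where open ≡-Reasoning

    score+shift : ∀ {k} → k < n → (score k + toℕ shift) mod n ≡ residue (p + k)
    score+shift {k} k<n = mod-cong (score k + toℕ shift) (unrolled (p + k)) (begin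
      (score k + toℕ shift) % n      ≡⟨ cong (λ t → (score k + t) % n) (toℕ-fromℕ< _) ⟩
      (score k + (p + μ) % n) % n    ≡⟨ [m+n%o]%o≡[m+n]%o (score k) (p + μ) n ⟩
      (score k + (p + μ)) % n        ≡⟨ cong (_% n) (m∸n+n≡m (p+μ≤unrolled k<n)) ⟩
      (unrolled (p + k) + n) % n     ≡⟨ [m+n]%n≡m%n (unrolled (p + k)) n ⟩
      unrolled (p + k) % n           ∎)
      where open ≡-Reasoning

    shifted-scores↭residues : applyUpTo (λ k → (score k + toℕ shift) mod n) n ↭ applyUpTo (λ k → A k mod n) n
    shifted-scores↭residues = begin
      applyUpTo (λ k → (score k + toℕ shift) mod n) n ≡⟨ applyUpTo-cong n score+shift ⟩
      applyUpTo (λ k → residue (p + k)) n             ↭⟨ applyUpTo-rotate residue (<⇒≤ p<n) residue-periodic ⟩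
      applyUpTo residue n                             ≡⟨ applyUpTo-cong n (cong (_mod n) ∘ unrolled-<) ⟩
      applyUpTo (λ k → A k mod n) n                   ∎
      where open PermutationReasoning

    shifted-score-sequence : ShiftedScoreSequence n (applyUpTo (λ k → A k mod n) n)
    shifted-score-sequence = s , shift ,
      isScoreSequence-tabulate score score-mono score-bounded (score-landau ∘ <⇒≤) score-total ,
      ↭-trans (↭-reflexive shifted-scores) shifted-scores↭residues
      where
      s : Vec ℕ n
      s = tabulate (score ∘ toℕ)
      shifted-scores : toList (map (λ x → (x + toℕ shift) mod n) s) ≡ applyUpTo (λ k → (score k + toℕ shift) mod n) n
      shifted-scores = trans (toList-map _ s) (trans (cong (List.map _) (toList-tabulate-toℕ score)) (map-applyUpTo score _ n))

  rotated-score-sequence : ShiftedScoreSequence n (applyUpTo (λ k → A k mod n) n)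
  rotated-score-sequence =
    case ∣-by-congruence n n ∑A≡ ∑gap of λ n∣∑gap →
    let μ       = quotient n∣∑gap
        ∑gap≡nμ = m∣n⇒n≡m*quotient n∣∑gap
    in case cycle-lemma gap μ gap-periodic ∑gap≡nμ of λ (p , p<n , climb) →
    Scores.shifted-score-sequence μ ∑gap≡nμ p p<n climb

lemma9 : (m : ℕ) → (M : Vec (Fin (suc m)) (suc m))
    → sum (toList (map toℕ M)) % suc m ≡ (suc m C 2) % suc m
    → Σ (Vec ℕ (suc m)) λ s → Σ (Fin (suc m)) λ j →
        IsScoreSequence (suc m) s
        × (toList (map (λ x → (x + toℕ j) mod suc m) s) ↭ toList M)
lemma9 m M ∑M≡ with nondecreasing-enumeration (map toℕ M)
... | A , A-mono , A↭M =
  ShiftedScoreSequence-resp-↭ residues↭M (RotatedScores.rotated-score-sequence m A A-mono A<n ∑A≡)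
  where
  A<n : ∀ {i} → i < suc m → A i < suc m
  A<n = applyUpTo⁻ A (suc m) (All-resp-↭ (↭-sym A↭M) (all-toℕ<n M))
  ∑A≡ : ∑< (suc m) A % suc m ≡ (suc m C 2) % suc m
  ∑A≡ = trans (cong (_% suc m) (sum-↭ A↭M)) ∑M≡
  residues↭M : applyUpTo (λ k → A k mod suc m) (suc m) ↭ toList M
  residues↭M = begin
    applyUpTo (λ k → A k mod suc m) (suc m)     ≡⟨ map-applyUpTo A (_mod suc m) (suc m) ⟨
    List.map (_mod suc m) (applyUpTo A (suc m)) ↭⟨ map⁺ (_mod suc m) A↭M ⟩
    List.map (_mod suc m) (toList (map toℕ M))  ≡⟨ map-mod-toℕ M ⟩
    toList M                                    ∎
    where open PermutationReasoning
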